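{- Let $\mathcal{G} = \{( \ \vdash x : C_{i,1}, \ldots, x : C_{i,k_{i}}) \ | \ 1 \leq i \leq n\}$ be an interpolant with $\mathrm{Lab}(\mathcal{G}) = \{x\}$. If $\Gamma \vdash \Delta, \Sigma$ is provable in $\mathsf{S}(\mathcal{O})$ for all $(\ \vdash \Sigma)$ in the orthogonal of $\mathcal{G}$, then $\mathsf{S}(\mathcal{O}) \Vdash \Gamma \vdash \Delta, x : \overline{\sqcap_{1 \leq i \leq n} \sqcup_{1 \leq j \leq k_{i}} C_{i,j}}$.
   Context: $\mathcal{O}$ is a $\mathcal{RIQ}$-ontology and $\mathsf{S}(\mathcal{O})$ is the sequent calculus for $\mathcal{O}$, containing among others the rules $(\sqcup)$: from $\Gamma \vdash x : C, x : D, \Delta$ infer $\Gamma \vdash x : C \sqcup D, \Delta$, and $(\sqcap)$: from $\Gamma \vdash x : C, \Delta$ and $\Gamma \vdash x : D, \Delta$ infer $\Gamma \vdash x : C \sqcap D, \Delta$. A sequent $\Gamma \vdash \Delta$ has $\Gamma$ a set of structural atoms forming a tree and $\Delta$ a multiset of labeled concepts $x : C$. For a concept $C$, $\overline{C}$ denotes its negation pushed into negation normal form (so $\overline{\sqcap_i \sqcup_j C_{i,j}} = \sqcup_i \sqcap_j \overline{C_{i,j}}$). The orthogonal of an interpolant $\mathcal{G} = \{\Gamma_i \vdash \Delta_i\}$ is the set of sequents obtained by choosing, for each member $\Gamma_i \vdash \Delta_i$ of $\mathcal{G}$, exactly one of its elements and negating it (an equality $x \dot{=} y$ becomes $x \not\dot{=}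 y$ in the antecedent and vice versa, a labeled concept $x : C$ becomes $x : \overline{C}$ in the consequent); for the $\mathcal{G}$ above, its members are the sequents $\ \vdash x : \overline{C_{1,j_1}}, \ldots, x : \overline{C_{n,j_n}}$ with $1 \leq j_i \leq k_i$. $\mathsf{S}(\mathcal{O}) \Vdash S$ means $S$ is provable in $\mathsf{S}(\mathcal{O})$. -}

module Defs where

open import Data.Nat using (ℕ; zero; suc)
open import Data.List using (List; []; _∷_; _++_; map)
open import Data.List.NonEmpty using (List⁺; _∷_)
open import Data.List.Membership.Propositional using (_∈_)
open import Data.List.Relation.Binary.Pointwise using (Pointwise)
open import Data.List.Relation.Binary.Permutation.Propositional using (_↭_)
open import Level using (Level)
open import Data.Product using (_×_) renaming (Σ to Σ′)
open import Relation.Binary.PropositionalEquality using (_≡_)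

ConceptName : Set
ConceptName = ℕ

RoleName : Set
RoleName = ℕ

Label : Set
Label = ℕ

data Role : Set where
  rn  : RoleName → Role
  inv : RoleName → Role

-- RIQ concepts in negation normal form.
data Concept : Set where
  ⊤c ⊥c     : Concept
  atom      : ConceptName → Concept
  natom     : ConceptName → Concept
  _⊓_ _⊔_   : Concept → Concept → Concept
  ∃[_]_     : Role → Concept → Concept
  ∀[_]_     : Role → Concept → Concept
  ≥[_,_]_   : ℕ → Role → Concept → Concept
  ≤[_,_]_   : ℕ → Role → Concept → Concept

neg : Concept → Concept
neg ⊤c              = ⊥c
neg ⊥c              = ⊤c
neg (atom A)        = natom A
neg (natom A)       = atom A
neg (C ⊓ D)         = neg C ⊔ neg D
neg (C ⊔ D)         = neg C ⊓ neg D
neg (∃[ R ] C)      = ∀[ R ] neg C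
neg (∀[ R ] C)      = ∃[ R ] neg C
neg (≥[ zero , R ] C)  = ⊥c
neg (≥[ suc n , R ] C) = ≤[ n , R ] C
neg (≤[ n , R ] C)     = ≥[ suc n , R ] C

data StructAtom : Set where
  edge : Label → Role → Label → StructAtom
  _≐_  : Label → Label → StructAtom
  _≠̇_  : Label → Label → StructAtom

record LConcept : Set where
  constructor _∶_
  field
    label   : Label
    concept : Concept

⊓⁺-aux : Concept → List Concept → Concept
⊓⁺-aux C []       = C
⊓⁺-aux C (D ∷ Ds) = C ⊓ ⊓⁺-aux D Ds

⊔⁺-aux : Concept → List Concept → Concept
⊔⁺-aux C []       = C
⊔⁺-aux C (D ∷ Ds) = C ⊔ ⊔⁺-aux D Ds

⋂ : List⁺ Concept → Concept
⋂ (C ∷ Cs) = ⊓⁺-aux C Cs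

⋃ : List⁺ Concept → Concept
⋃ (C ∷ Cs) = ⊔⁺-aux C Cs

-- An interpolant of the shape { ( ⊢ x : C_{i,1}, …, x : C_{i,k_i}) | 1 ≤ i ≤ n }
-- with Lab = {x} is represented by the label x and the non-empty list (over i)
-- of non-empty lists (over j) of concepts C_{i,j}.
Matrix : Set
Matrix = List⁺ (List⁺ Concept)

rowsL : Matrix → List (List Concept)
rowsL ((r ∷ rs) ∷ rows) = (r ∷ rs) ∷ rowsL′ rows
  where
  rowsL′ : List (List⁺ Concept) → List (List Concept)
  rowsL′ []               = []
  rowsL′ ((c ∷ cs) ∷ rss) = (c ∷ cs) ∷ rowsL′ rss

⊓⊔ : Matrix → Concept
⊓⊔ (r ∷ rs) = ⋂ (⋃ r ∷ map ⋃ rs)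

Orth : Label → Matrix → List LConcept → Set
Orth x G Σ = Σ′ (List Concept) λ cs →
               Pointwise _∈_ cs (rowsL G) × (Σ ≡ map (λ c → x ∶ neg c) cs)

-- A sequent calculus S(O) for a RIQ-ontology O, given by its provability
-- relation on sequents Γ ⊢ Δ (Γ a list of structural atoms, Δ a multiset of
-- labeled concepts, represented by a list taken up to permutation), which
-- contains among others the rules (⊔) and (⊓).
record SequentCalculus ℓ : Set (Level.suc ℓ) where
  field
    _⊩_   : List StructAtom → List LConcept → Set ℓ
    perm  : ∀ {Γ Δ Δ′} → Γ ⊩ Δ → Δ ↭ Δ′ → Γ ⊩ Δ′
    ⊔-rule : ∀ {Γ Δ x C D} → Γ ⊩ ((x ∶ C) ∷ (x ∶ D) ∷ Δ) → Γ ⊩ ((x ∶ (C ⊔ D)) ∷ Δ)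
    ⊓-rule : ∀ {Γ Δ x C D} → Γ ⊩ ((x ∶ C) ∷ Δ) → Γ ⊩ ((x ∶ D) ∷ Δ)
             → Γ ⊩ ((x ∶ (C ⊓ D)) ∷ Δ)

-- Pushing the negation inward, neg (⊓ᵢ ⊔ⱼ Cᵢⱼ) = ⊔ᵢ ⊓ⱼ neg Cᵢⱼ. Reading the goal
-- bottom-up, (⊔) splits this disjunction into one formula per row i, and (⊓)
-- then branches on each row over the choice of a conjunct neg Cᵢⱼ. After all
-- rows are decomposed, each branch is Γ ⊢ Δ, Σ for the Σ in the orthogonal of G
-- given by the choices made along it, which is provable by hypothesis.
module Submission where

open import Defs
open import Data.List using (List; _++_; _∷_; []; map)
open import Data.List.NonEmpty using (List⁺; _∷_)
open import Data.List.Membership.Propositional using (_∈_)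
open import Data.List.Relation.Unary.Any using (here; there)
open import Data.List.Relation.Binary.Pointwise using (Pointwise; []; _∷_)
open import Data.List.Relation.Binary.Permutation.Propositional using (↭-sym; ↭-refl; swap)
open import Data.List.Relation.Binary.Permutation.Propositional.Properties using (shift; ++-comm)
open import Data.Product using (_,_)
open import Relation.Binary.PropositionalEquality using (refl)

negatedAt : Label → List Concept → List LConcept
negatedAt x = map (λ C → x ∶ neg C)

module _ {ℓ} (S : SequentCalculus ℓ) (Γ : List StructAtom) where
  open SequentCalculus S

  ⊩-++-comm : ∀ Δ Σ → Γ ⊩ (Δ ++ Σ) → Γ ⊩ (Σ ++ Δ)
  ⊩-++-comm Δ Σ ⊢Δ,Σ = perm ⊢Δ,Σ (++-comm Δ Σ)

  ⊩-neg-⊔⁺ : ∀ x C Cs Δ → (∀ D → D ∈ C ∷ Cs → Γ ⊩ ((x ∶ neg D) ∷ Δ)) →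
             Γ ⊩ ((x ∶ neg (⊔⁺-aux C Cs)) ∷ Δ)
  ⊩-neg-⊔⁺ x C []       Δ ⊢each = ⊢each C (here refl)
  ⊩-neg-⊔⁺ x C (D ∷ Ds) Δ ⊢each =
    ⊓-rule (⊢each C (here refl)) (⊩-neg-⊔⁺ x D Ds Δ (λ E E∈ → ⊢each E (there E∈)))

  ⊩-neg-⊓⊔ : ∀ x r rs Δ →
             (∀ Cs → Pointwise _∈_ Cs (rowsL (r ∷ rs)) → Γ ⊩ (negatedAt x Cs ++ Δ)) →
             Γ ⊩ ((x ∶ neg (⊓⊔ (r ∷ rs))) ∷ Δ)
  ⊩-neg-⊓⊔ x (C ∷ Cs) [] Δ ⊢choices =
    ⊩-neg-⊔⁺ x C Cs Δ (λ D D∈ → ⊢choices (D ∷ []) (D∈ ∷ []))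
  ⊩-neg-⊓⊔ x (C ∷ Cs) (r′ ∷ rs′) Δ ⊢choices = ⊔-rule (⊩-neg-⊔⁺ x C Cs _ ⊢first-choice)
    where
    ⊢first-choice : ∀ D → D ∈ C ∷ Cs →
                    Γ ⊩ ((x ∶ neg D) ∷ (x ∶ neg (⊓⊔ (r′ ∷ rs′))) ∷ Δ)
    ⊢first-choice D D∈ = perm (⊩-neg-⊓⊔ x r′ rs′ ((x ∶ neg D) ∷ Δ) ⊢later-choices)
                              (swap _ _ ↭-refl)
      where
      ⊢later-choices : ∀ Ds → Pointwise _∈_ Ds (rowsL (r′ ∷ rs′)) →
                       Γ ⊩ (negatedAt x Ds ++ (x ∶ neg D) ∷ Δ)
      ⊢later-choices Ds Ds∈ =
        perm (⊢choices (D ∷ Ds) (D∈ ∷ Ds∈)) (↭-sym (shift (x ∶ neg D) (negatedAt x Ds) Δ))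

lemma9 : ∀ {ℓ} (S : SequentCalculus ℓ) → let open SequentCalculus S in
    (x : Label) (G : Matrix) (Γ : List StructAtom) (Δ : List LConcept) →
    (∀ Σ → Orth x G Σ → Γ ⊩ (Δ ++ Σ)) →
    Γ ⊩ (Δ ++ ((x ∶ neg (⊓⊔ G)) ∷ []))
lemma9 S x (r ∷ rs) Γ Δ ⊢orth =
  ⊩-++-comm S Γ (_ ∷ []) Δ
    (⊩-neg-⊓⊔ S Γ x r rs Δ λ Cs Cs∈ →
      ⊩-++-comm S Γ Δ (negatedAt x Cs) (⊢orth _ (Cs , Cs∈ , refl)))
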